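{- For every integer $n \geq 3$, $$\mathrm{nbet}(n) = \left\lceil \log_2\log_2 n \right\rceil + 1.$$
   Context: Let $n\ge 3$ and $[n]=\{1,\dots,n\}$. An ordering is a bijection $\phi:[n]\to[n]$; $\phi(x)$ is the position of $x$, and $x$ comes before $y$ in $\phi$ if $\phi(x)<\phi(y)$. A ternary constraint is a triple $(x_1,x_2,x_3)$ of distinct elements of $[n]$. An ordering $\phi$ between-satisfies $(x_1,x_2,x_3)$ if $x_2$ lies between $x_1$ and $x_3$ in $\phi$, i.e. $\phi(x_1)<\phi(x_2)<\phi(x_3)$ or $\phi(x_3)<\phi(x_2)<\phi(x_1)$. It nonbetween-satisfies the constraint otherwise. An order-system is a set of orderings on $[n]$. It nonbetween-satisfies a constraint if at least one of its orderings does. $\mathrm{nbet}(n)$ is the minimum size of an order-system on $[n]$ that nonbetween-satisfies every ternary constraint. -}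

module Defs where

open import Data.Nat using (ℕ; _≤_)
open import Data.Fin using (Fin; _<_)
open import Data.Fin.Permutation using (Permutation′; _⟨$⟩ʳ_)
open import Data.List using (List; length)
open import Data.List.Relation.Unary.Any using (Any)
open import Data.Product using (_×_; ∃-syntax)
open import Data.Sum using (_⊎_)
open import Relation.Nullary using (¬_)
open import Relation.Binary.PropositionalEquality using (_≡_)

-- The ground set [n] is represented by Fin n.
-- An ordering is a bijection φ : [n] → [n]; φ ⟨$⟩ʳ x is the position of x.
Ordering : ℕ → Set
Ordering n = Permutation′ n

record Constraint (n : ℕ) : Set where
  constructor constraint
  field
    x₁ x₂ x₃ : Fin n
    x₁≢x₂ : ¬ (x₁ ≡ x₂)
    x₁≢x₃ : ¬ (x₁ ≡ x₃)
    x₂≢x₃ : ¬ (x₂ ≡ x₃)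

BetweenSat : {n : ℕ} → Ordering n → Constraint n → Set
BetweenSat φ c =
  ((φ ⟨$⟩ʳ x₁) < (φ ⟨$⟩ʳ x₂) × (φ ⟨$⟩ʳ x₂) < (φ ⟨$⟩ʳ x₃))
  ⊎ ((φ ⟨$⟩ʳ x₃) < (φ ⟨$⟩ʳ x₂) × (φ ⟨$⟩ʳ x₂) < (φ ⟨$⟩ʳ x₁))
  where open Constraint c

NonBetweenSat : {n : ℕ} → Ordering n → Constraint n → Set
NonBetweenSat φ c = ¬ BetweenSat φ c

OrderSystem : ℕ → Set
OrderSystem n = List (Ordering n)

SysNonBetweenSat : {n : ℕ} → OrderSystem n → Constraint n → Set
SysNonBetweenSat S c = Any (λ φ → NonBetweenSat φ c) S

NonBetweenAll : {n : ℕ} → OrderSystem n → Set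
NonBetweenAll {n} S = (c : Constraint n) → SysNonBetweenSat S c

IsNbet : ℕ → ℕ → Set
IsNbet n k =
  (∃[ S ] (length {A = Ordering n} S ≡ k × NonBetweenAll S))
  × ((S : OrderSystem n) → NonBetweenAll S → k ≤ length S)

module Submission where

-- nbet(n) = ⌈log₂ ⌈log₂ n ⌉ ⌉ + 1 for n ≥ 3.  Write tower k = 2 ^ 2 ^ k, so
-- the claim is that k + 1 orderings can nonbetween-satisfy every constraint on
-- [n] exactly when n ≤ tower k.  Orderings are handled through keys: maps to ℕ
-- compared by value, the position map of an ordering being the basic example.
--
-- Lower bound (module LowerBound): if k + 1 injective keys separate every
-- triple of a set X, i.e. some key does not put the middle element between the
-- outer two, then |X| ≤ tower k.  One key separates at most 2 elements, and an
-- Erdős–Szekeres argument shows that each further key at most squares the bound.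
--
-- Upper bound (SquaredFamily, family): keys on [0, m) separating all triples
-- lift to keys on [0, m * m), viewed as pairs of base-m digits, with only one
-- key more: lexicographic squares plus one key reversing the low digit.  The
-- keys of level k are turned into orderings of [n] ⊆ [0, tower k) by ranking.

open import Defs
open import Data.Nat using (ℕ; zero; suc; _+_; _*_; _∸_; _≤_; _<_; z≤n; s≤s; z<s; NonZero; _/_; _%_; _<ᵇ_; _^_; ⌈_/2⌉)
open import Data.Nat.Logarithm using (⌈log₂_⌉; ⌈log₂⌉-mono-≤; ⌈log₂2^n⌉≡n)
open import Data.Nat.Logarithm.Core using (⌈log2⌉)
open import Induction.WellFounded using (Acc; acc)
open import Data.Nat.DivMod using (m≡m%n+[m/n]*n; m%n<n; m<n*o⇒m/o<n)
open import Data.Nat.Properties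
open import Data.List using (List; []; _∷_; [_]; length; filter; map; allFin)
open import Data.List.Membership.Propositional using (_∈_; find; lose)
open import Data.List.Membership.Propositional.Properties using (∈-filter⁻)
open import Data.List.Properties using (length-map; length-tabulate)
open import Data.List.Relation.Binary.Subset.Propositional using (_⊆_)
open import Data.List.Relation.Unary.All using (All; []; _∷_)
import Data.List.Relation.Unary.All as All
open import Data.List.Relation.Unary.AllPairs using (AllPairs; _∷_)
import Data.List.Relation.Unary.AllPairs as AllPairs
open import Data.List.Relation.Unary.Any using (Any; here; there; any?)
open import Data.List.Relation.Unary.Any.Properties using (map⁺; ¬Any[])
import Data.List.Relation.Unary.All.Properties as AllP
import Data.List.Relation.Unary.Any as Any
open import Data.List.Relation.Unary.Linked using (Linked; [-]; _∷_)
open import Data.List.Relation.Unary.Linked.Properties using (Linked⇒AllPairs)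
open import Data.List.Relation.Unary.Unique.Propositional using (Unique)
open import Data.List.Relation.Unary.Unique.Propositional.Properties using (filter⁺; allFin⁺)
open import Data.Product using (_×_; _,_; proj₁; proj₂; ∃)
open import Data.Sum using (_⊎_; inj₁; inj₂; swap)
open import Data.Empty using (⊥; ⊥-elim)
open import Function using (_∘_)
open import Function.Definitions using (Injective)
open import Function.Bundles using (Equivalence)
open import Data.Bool.Properties using (T-≡)
open import Data.Fin using (Fin; zero; suc; toℕ; fromℕ<; punchOut)
import Data.Fin.Properties as Fin
open import Data.Fin.Properties using (toℕ-injective; toℕ-fromℕ<; pigeonhole; punchOut-injective)
open import Data.Fin.Permutation using (permutation; _⟨$⟩ʳ_; _⟨$⟩ˡ_; inverseˡ)
open import Data.Fin.Subset using (Subset; ∣_∣) renaming (_∈_ to _∈ₛ_)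
open import Data.Fin.Subset.Properties using (∈⊤; ∣⊤∣≡n; p⊂q⇒∣p∣<∣q∣)
open import Data.Vec using (tabulate)
open import Data.Vec.Properties using (lookup∘tabulate; lookup⇒[]=; []=⇒lookup)
open import Relation.Nullary using (¬_; Dec; yes; no; ¬?)
open import Relation.Nullary.Decidable using (_×-dec_; _⊎-dec_)
open import Relation.Unary using (Decidable)
open import Relation.Binary.Definitions using (tri<; tri≈; tri>)
open import Relation.Binary.PropositionalEquality using (_≡_; _≢_; refl; sym; trans; cong; cong₂; subst; subst₂; ≢-sym; module ≡-Reasoning)

InBetween : ℕ → ℕ → ℕ → Set
InBetween p q r = (p < q × q < r) ⊎ (r < q × q < p)

-- Of three distinct numbers, one lies between the other two.  This is why a
-- single ordering cannot nonbetween-satisfy all constraints on three elements.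
some-in-between : ∀ {p q r} → p ≢ q → p ≢ r → q ≢ r →
  InBetween p q r ⊎ InBetween q p r ⊎ InBetween p r q
some-in-between {p} {q} {r} p≢q p≢r q≢r with <-cmp p q | <-cmp q r | <-cmp p r
... | tri≈ _ p≡q _ | _            | _            = ⊥-elim (p≢q p≡q)
... | _            | tri≈ _ q≡r _ | _            = ⊥-elim (q≢r q≡r)
... | _            | _            | tri≈ _ p≡r _ = ⊥-elim (p≢r p≡r)
... | tri< p<q _ _ | tri< q<r _ _ | _            = inj₁ (inj₁ (p<q , q<r))
... | tri< p<q _ _ | tri> _ _ r<q | tri< p<r _ _ = inj₂ (inj₂ (inj₁ (p<r , r<q)))
... | tri< p<q _ _ | tri> _ _ r<q | tri> _ _ r<p = inj₂ (inj₁ (inj₂ (r<p , p<q)))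
... | tri> _ _ q<p | tri< q<r _ _ | tri< p<r _ _ = inj₂ (inj₁ (inj₁ (q<p , p<r)))
... | tri> _ _ q<p | tri< q<r _ _ | tri> _ _ r<p = inj₂ (inj₂ (inj₂ (q<r , r<p)))
... | tri> _ _ q<p | tri> _ _ r<q | _            = inj₁ (inj₂ (r<q , q<p))

-- A key κ : A → ℕ orders A by comparing values; b lies between a and c in it.
-- For the key x ↦ position of x in an ordering φ this is exactly BetweenSat.
Between : {A : Set} → (A → ℕ) → A → A → A → Set
Between κ a b c = InBetween (κ a) (κ b) (κ c)

Separates : {A : Set} → List (A → ℕ) → A → A → A → Set
Separates Ks a b c = Any (λ κ → ¬ Between κ a b c) Ks

between-sym : {A : Set} {κ : A → ℕ} {a b c : A} → Between κ a b c → Between κ c b a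
between-sym = swap

OrderPreserving OrderReversing : {A : Set} → (A → Set) → (A → ℕ) → (A → ℕ) → Set
OrderPreserving P κ λ′ = ∀ {x y} → P x → P y → κ x < κ y → λ′ x < λ′ y
OrderReversing P κ λ′ = ∀ {x y} → P x → P y → κ x < κ y → λ′ y < λ′ x

preserving⇒between : {A : Set} (P : A → Set) {κ λ′ : A → ℕ} → OrderPreserving P κ λ′ →
  ∀ {a b c} → P a → P b → P c → Between κ a b c → Between λ′ a b c
preserving⇒between _ f pa pb pc (inj₁ (p , q)) = inj₁ (f pa pb p , f pb pc q)
preserving⇒between _ f pa pb pc (inj₂ (p , q)) = inj₂ (f pc pb p , f pb pa q)

reversing⇒between : {A : Set} (P : A → Set) {κ λ′ : A → ℕ} → OrderReversing P κ λ′ →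
  ∀ {a b c} → P a → P b → P c → Between κ a b c → Between λ′ a b c
reversing⇒between _ f pa pb pc (inj₁ (p , q)) = inj₂ (f pb pc q , f pa pb p)
reversing⇒between _ f pa pb pc (inj₂ (p , q)) = inj₁ (f pb pa q , f pc pb p)

-- tower k = 2 ^ 2 ^ k, the largest ground set k + 1 orderings can handle.
tower : ℕ → ℕ
tower zero = 2
tower (suc k) = tower k * tower k

module LowerBound {A : Set} where

  SeparatedOn : List (A → ℕ) → List A → Set
  SeparatedOn Ks X = ∀ {a b c} → a ∈ X → b ∈ X → c ∈ X → a ≢ b → a ≢ c → b ≢ c →
    Separates Ks a b c

  SizeBound : List (A → ℕ) → ℕ → Set
  SizeBound Ks B = ∀ X → Unique X → SeparatedOn Ks X → length X ≤ B

  separatedOn-⊆ : ∀ {Ks X Y} → Y ⊆ X → SeparatedOn Ks X → SeparatedOn Ks Y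
  separatedOn-⊆ Y⊆X sep a∈Y b∈Y c∈Y = sep (Y⊆X a∈Y) (Y⊆X b∈Y) (Y⊆X c∈Y)

  drop-redundant-key : ∀ {κ₀ κ₁ Ks X Y} → Y ⊆ X → SeparatedOn (κ₀ ∷ κ₁ ∷ Ks) X →
    (∀ {a b c} → a ∈ Y → b ∈ Y → c ∈ Y → Between κ₀ a b c → Between κ₁ a b c) →
    SeparatedOn (κ₀ ∷ Ks) Y
  drop-redundant-key Y⊆X sep κ₀⇒κ₁ a∈Y b∈Y c∈Y a≢b a≢c b≢c
    with sep (Y⊆X a∈Y) (Y⊆X b∈Y) (Y⊆X c∈Y) a≢b a≢c b≢c
  ... | here ¬b₀             = here ¬b₀
  ... | there (here ¬b₁)     = here (λ b₀ → ¬b₁ (κ₀⇒κ₁ a∈Y b∈Y c∈Y b₀))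
  ... | there (there others) = there others

  one-key-bound : ∀ {κ} → Injective _≡_ _≡_ κ → SizeBound [ κ ] 2
  one-key-bound κ-inj [] _ _ = z≤n
  one-key-bound κ-inj (_ ∷ []) _ _ = s≤s z≤n
  one-key-bound κ-inj (_ ∷ _ ∷ []) _ _ = s≤s (s≤s z≤n)
  one-key-bound κ-inj (a ∷ b ∷ c ∷ rest) ((a≢b ∷ a≢c ∷ _) ∷ (b≢c ∷ _) ∷ _) sep
    with sep a∈ b∈ c∈ a≢b a≢c b≢c
       | sep b∈ a∈ c∈ (≢-sym a≢b) b≢c a≢c
       | sep a∈ c∈ b∈ a≢c a≢b (≢-sym b≢c)
    where
    a∈ : a ∈ a ∷ b ∷ c ∷ rest
    a∈ = here refl
    b∈ : b ∈ a ∷ b ∷ c ∷ rest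
    b∈ = there (here refl)
    c∈ : c ∈ a ∷ b ∷ c ∷ rest
    c∈ = there (there (here refl))
  ... | here ¬abc | here ¬bac | here ¬acb
    with some-in-between (λ e → a≢b (κ-inj e)) (λ e → a≢c (κ-inj e)) (λ e → b≢c (κ-inj e))
  ... | inj₁ abc        = ⊥-elim (¬abc abc)
  ... | inj₂ (inj₁ bac) = ⊥-elim (¬bac bac)
  ... | inj₂ (inj₂ acb) = ⊥-elim (¬acb acb)

  length-filter-split : {P : A → Set} (P? : Decidable P) (xs : List A) →
    length (filter P? xs) + length (filter (¬? ∘ P?) xs) ≡ length xs
  length-filter-split P? [] = refl
  length-filter-split P? (x ∷ xs) with P? x
  ... | yes _ = cong suc (length-filter-split P? xs)
  ... | no _ = trans (+-suc _ _) (cong suc (length-filter-split P? xs))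

  -- Erdős–Szekeres step: adding an injective key κ₁ to a family whose leading
  -- key is κ₀ at most squares the size bound B.  Order A by dominance in both
  -- κ₀ and κ₁.  On a chain κ₁ agrees with κ₀ and on an antichain it reverses
  -- κ₀; either way κ₁ is redundant there, so chains and antichains have at
  -- most B members.  Peeling off minimal elements splits a list into at most
  -- B antichains, hence it has at most B * B members.
  module Squaring (κ₀ κ₁ : A → ℕ) (κ₁-inj : Injective _≡_ _≡_ κ₁) (Ks : List (A → ℕ))
                  (B : ℕ) (bound : SizeBound (κ₀ ∷ Ks) B) where

    _≺_ : A → A → Set
    x ≺ y = κ₀ x < κ₀ y × κ₁ x < κ₁ y

    _≺?_ : ∀ x y → Dec (x ≺ y)
    x ≺? y = (κ₀ x <? κ₀ y) ×-dec (κ₁ x <? κ₁ y)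

    ≺-trans : ∀ {x y z} → x ≺ y → y ≺ z → x ≺ z
    ≺-trans (p , q) (r , s) = <-trans p r , <-trans q s

    Chain : List A → List A → Set
    Chain X C = All (_∈ X) C × Linked _≺_ C

    chain-ordered : ∀ {C} → Linked _≺_ C → AllPairs _≺_ C
    chain-ordered = Linked⇒AllPairs ≺-trans

    chain-unique : ∀ {C} → Linked _≺_ C → Unique C
    chain-unique linked = AllPairs.map (λ (p , _) e → <-irrefl (cong κ₀ e) p) (chain-ordered linked)

    chain-comparable : ∀ {C} → AllPairs _≺_ C → ∀ {x y} → x ∈ C → y ∈ C → x ≢ y → x ≺ y ⊎ y ≺ x
    chain-comparable (_ ∷ _) (here refl) (here refl) x≢y = ⊥-elim (x≢y refl)
    chain-comparable (x≺ ∷ _) (here refl) (there y∈) _ = inj₁ (All.lookup x≺ y∈)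
    chain-comparable (y≺ ∷ _) (there x∈) (here refl) _ = inj₂ (All.lookup y≺ x∈)
    chain-comparable (_ ∷ ordered) (there x∈) (there y∈) x≢y = chain-comparable ordered x∈ y∈ x≢y

    chain-bound : ∀ {X C} → SeparatedOn (κ₀ ∷ κ₁ ∷ Ks) X → Chain X C → length C ≤ B
    chain-bound {X} {C} sep (C⊆X , linked) = bound C (chain-unique linked)
      (drop-redundant-key (All.lookup C⊆X) sep (preserving⇒between (_∈ C) agrees))
      where
      agrees : OrderPreserving (_∈ C) κ₀ κ₁
      agrees x∈ y∈ κ₀x<κ₀y with chain-comparable (chain-ordered linked) x∈ y∈
                                  (λ { refl → <-irrefl refl κ₀x<κ₀y })
      ... | inj₁ (_ , κ₁x<κ₁y) = κ₁x<κ₁y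
      ... | inj₂ (κ₀y<κ₀x , _) = ⊥-elim (<-asym κ₀x<κ₀y κ₀y<κ₀x)

    -- Induction on the length D of the longest chain, removing the minimal
    -- elements (which form an antichain) at each step.
    height-bound : ∀ D X → Unique X → SeparatedOn (κ₀ ∷ κ₁ ∷ Ks) X →
      (∀ C → Chain X C → length C ≤ D) → length X ≤ D * B
    height-bound zero [] _ _ _ = z≤n
    height-bound zero (x ∷ X) _ _ chains with chains [ x ] ((here refl ∷ []) , [-])
    ... | ()
    height-bound (suc D) X unique sep chains = begin
        length X
      ≡⟨ length-filter-split HasPredecessor? X ⟨
        length Upper + length Minimal
      ≤⟨ +-mono-≤ (height-bound D Upper (filter⁺ _ unique) (separatedOn-⊆ Upper⊆X sep) upper-chains)
                  (bound Minimal (filter⁺ _ unique) minimal-separated) ⟩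
        D * B + B
      ≡⟨ +-comm (D * B) B ⟩
        suc D * B ∎
      where
      open ≤-Reasoning
      HasPredecessor : A → Set
      HasPredecessor x = Any (_≺ x) X
      HasPredecessor? : Decidable HasPredecessor
      HasPredecessor? x = any? (_≺? x) X
      Upper Minimal : List A
      Upper = filter HasPredecessor? X
      Minimal = filter (¬? ∘ HasPredecessor?) X
      Upper⊆X : Upper ⊆ X
      Upper⊆X x∈ = proj₁ (∈-filter⁻ HasPredecessor? {xs = X} x∈)
      Minimal⊆X : Minimal ⊆ X
      Minimal⊆X x∈ = proj₁ (∈-filter⁻ (¬? ∘ HasPredecessor?) {xs = X} x∈)
      -- every chain of Upper extends downwards by a predecessor of its least member
      upper-chains : ∀ C → Chain Upper C → length C ≤ D
      upper-chains [] _ = z≤n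
      upper-chains (c ∷ C) (c∈ ∷ C⊆ , linked) with find (proj₂ (∈-filter⁻ HasPredecessor? {xs = X} c∈))
      ... | z , z∈X , z≺c = ≤-pred (chains (z ∷ c ∷ C) ((z∈X ∷ All.map Upper⊆X (c∈ ∷ C⊆)) , (z≺c ∷ linked)))
      minimal-reversed : OrderReversing (_∈ Minimal) κ₀ κ₁
      minimal-reversed {x} {y} x∈ y∈ κ₀x<κ₀y with <-cmp (κ₁ x) (κ₁ y)
      ... | tri< κ₁x<κ₁y _ _ =
        ⊥-elim (proj₂ (∈-filter⁻ (¬? ∘ HasPredecessor?) {xs = X} y∈) (lose (Minimal⊆X x∈) (κ₀x<κ₀y , κ₁x<κ₁y)))
      ... | tri≈ _ κ₁x≡κ₁y _ = ⊥-elim (<-irrefl (cong κ₀ (κ₁-inj κ₁x≡κ₁y)) κ₀x<κ₀y)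
      ... | tri> _ _ κ₁y<κ₁x = κ₁y<κ₁x
      minimal-separated : SeparatedOn (κ₀ ∷ Ks) Minimal
      minimal-separated = drop-redundant-key Minimal⊆X sep (reversing⇒between (_∈ Minimal) minimal-reversed)

    squaring-bound : SizeBound (κ₀ ∷ κ₁ ∷ Ks) (B * B)
    squaring-bound X unique sep = height-bound B X unique sep (λ C → chain-bound sep)

  lower-bound : (κ₀ : A → ℕ) (Ks : List (A → ℕ)) → Injective _≡_ _≡_ κ₀ → All (Injective _≡_ _≡_) Ks →
    SizeBound (κ₀ ∷ Ks) (tower (length Ks))
  lower-bound κ₀ [] κ₀-inj [] = one-key-bound κ₀-inj
  lower-bound κ₀ (κ₁ ∷ Ks) κ₀-inj (κ₁-inj ∷ Ks-inj) =
    Squaring.squaring-bound κ₀ κ₁ κ₁-inj Ks (tower (length Ks)) (lower-bound κ₀ Ks κ₀-inj Ks-inj)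

two-digit-< : ∀ {m a b c d} → b < m → a < c → a * m + b < c * m + d
two-digit-< {m} {a} {b} {c} {d} b<m a<c = begin-strict
    a * m + b   <⟨ +-monoʳ-< (a * m) b<m ⟩
    a * m + m   ≡⟨ +-comm (a * m) m ⟩
    suc a * m   ≤⟨ *-monoˡ-≤ m a<c ⟩
    c * m       ≤⟨ m≤m+n (c * m) d ⟩
    c * m + d   ∎
  where open ≤-Reasoning

two-digit-<-inv : ∀ {m a b c d} → b < m → d < m → a * m + b < c * m + d → a < c ⊎ (a ≡ c × b < d)
two-digit-<-inv {m} {a} {b} {c} {d} b<m d<m lt with <-cmp a c
... | tri< a<c _ _ = inj₁ a<c
... | tri≈ _ refl _ = inj₂ (refl , +-cancelˡ-< (a * m) b d lt)
... | tri> _ _ c<a = ⊥-elim (<-asym lt (two-digit-< d<m c<a))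

two-digit-injective : ∀ {m a b c d} → b < m → d < m → a * m + b ≡ c * m + d → a ≡ c × b ≡ d
two-digit-injective {m} {a} {b} {c} {d} b<m d<m eq with <-cmp a c
... | tri< a<c _ _ = ⊥-elim (<-irrefl eq (two-digit-< b<m a<c))
... | tri≈ _ refl _ = refl , +-cancelˡ-≡ (a * m) b d eq
... | tri> _ _ c<a = ⊥-elim (<-irrefl (sym eq) (two-digit-< d<m c<a))

-- An ordering of the ground set [0, m), given by the positions of its elements.
record Key (m : ℕ) : Set where
  field
    pos : ℕ → ℕ
    pos-< : ∀ {x} → x < m → pos x < m
    pos-injective : ∀ {x y} → x < m → y < m → pos x ≡ pos y → x ≡ y
open Key

KeySeparates : {m : ℕ} → List (Key m) → ℕ → ℕ → ℕ → Set
KeySeparates Ks a b c = Any (λ K → ¬ Between (pos K) a b c) Ks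

key-separates-sym : ∀ {m} {Ks : List (Key m)} {a b c} → KeySeparates Ks a b c → KeySeparates Ks c b a
key-separates-sym = Any.map (λ {K} ¬between between → ¬between (between-sym {κ = pos K} between))

SeparatesBelow : (m : ℕ) → List (Key m) → Set
SeparatesBelow m Ks = ∀ {a b c} → a < m → b < m → c < m → a ≢ b → a ≢ c → b ≢ c →
  KeySeparates Ks a b c

-- Squaring the ground set: e ∈ [0, m * m) is the pair of digits (high e , low e).
module Lexicographic (m : ℕ) {{_ : NonZero m}} where

  high low : ℕ → ℕ
  high e = e / m
  low e = e % m

  high-< : ∀ {x} → x < m * m → high x < m
  high-< = m<n*o⇒m/o<n

  low-< : ∀ {x} → low x < m
  low-< {x} = m%n<n x m

  digits-injective : ∀ {x y} → high x ≡ high y → low x ≡ low y → x ≡ y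
  digits-injective {x} {y} hx≡hy lx≡ly = begin
    x                     ≡⟨ m≡m%n+[m/n]*n x m ⟩
    low x + high x * m    ≡⟨ cong₂ (λ l h → l + h * m) lx≡ly hx≡hy ⟩
    low y + high y * m    ≡⟨ m≡m%n+[m/n]*n y m ⟨
    y                     ∎
    where open ≡-Reasoning

  lex : Key m → Key m → Key (m * m)
  lex F G = record { pos = lex-pos ; pos-< = lex-pos-< ; pos-injective = lex-pos-injective }
    where
    lex-pos : ℕ → ℕ
    lex-pos e = pos F (high e) * m + pos G (low e)
    lex-pos-< : ∀ {x} → x < m * m → lex-pos x < m * m
    lex-pos-< {x} x< = ≤-trans (two-digit-< {d = 0} (pos-< G low-<) (pos-< F (high-< x<)))
                              (≤-reflexive (+-identityʳ (m * m)))
    lex-pos-injective : ∀ {x y} → x < m * m → y < m * m → lex-pos x ≡ lex-pos y → x ≡ y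
    lex-pos-injective {x} {y} x< y< eq with two-digit-injective (pos-< G (low-< {x})) (pos-< G (low-< {y})) eq
    ... | high-eq , low-eq = digits-injective (pos-injective F (high-< x<) (high-< y<) high-eq)
                                              (pos-injective G low-< low-< low-eq)

  reverse : Key m → Key m
  reverse F = record { pos = λ x → m ∸ suc (pos F x) ; pos-< = rev-< ; pos-injective = rev-injective }
    where
    rev-< : ∀ {x} → x < m → m ∸ suc (pos F x) < m
    rev-< {x} x< = ∸-monoʳ-< {m} {suc (pos F x)} {0} z<s (pos-< F x<)
    rev-injective : ∀ {x y} → x < m → y < m → m ∸ suc (pos F x) ≡ m ∸ suc (pos F y) → x ≡ y
    rev-injective x< y< eq = pos-injective F x< y< (suc-injective (∸-cancelˡ-≡ (pos-< F x<) (pos-< F y<) eq))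

  reverse-< : ∀ F {x y} → x < m → y < m → pos F x < pos F y → pos (reverse F) y < pos (reverse F) x
  reverse-< F x< y< lt = ∸-monoʳ-< (s≤s lt) (pos-< F y<)

  module _ (F G : Key m) where

    lex-<-inv : ∀ {x y} → pos (lex F G) x < pos (lex F G) y →
      pos F (high x) < pos F (high y) ⊎ (pos F (high x) ≡ pos F (high y) × pos G (low x) < pos G (low y))
    lex-<-inv {x} {y} = two-digit-<-inv (pos-< G (low-< {x})) (pos-< G (low-< {y}))

    lex-<-high : ∀ {x y} → x < m * m → y < m * m → high x ≢ high y →
      pos (lex F G) x < pos (lex F G) y → pos F (high x) < pos F (high y)
    lex-<-high x< y< hx≢hy lt with lex-<-inv lt
    ... | inj₁ F< = F<
    ... | inj₂ (F≡ , _) = ⊥-elim (hx≢hy (pos-injective F (high-< x<) (high-< y<) F≡))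

    high-<-lex : ∀ {x y} → pos F (high x) < pos F (high y) → pos (lex F G) x < pos (lex F G) y
    high-<-lex {x} lt = two-digit-< (pos-< G (low-< {x})) lt

    lex-<-low : ∀ {x y} → high x ≡ high y → pos (lex F G) x < pos (lex F G) y → pos G (low x) < pos G (low y)
    lex-<-low hx≡hy lt with lex-<-inv lt
    ... | inj₁ F< = ⊥-elim (<-irrefl (cong (pos F) hx≡hy) F<)
    ... | inj₂ (_ , G<) = G<

    low-<-lex : ∀ {x y} → high x ≡ high y → pos G (low x) < pos G (low y) → pos (lex F G) x < pos (lex F G) y
    low-<-lex {x} {y} hx≡hy lt rewrite hx≡hy = +-monoʳ-< (pos F (high y) * m) lt

    between-high : ∀ {a b c} → a < m * m → b < m * m → c < m * m →
      high a ≢ high b → high b ≢ high c →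
      Between (pos (lex F G)) a b c → Between (pos F) (high a) (high b) (high c)
    between-high a< b< c< ha≢hb hb≢hc (inj₁ (p , q)) =
      inj₁ (lex-<-high a< b< ha≢hb p , lex-<-high b< c< hb≢hc q)
    between-high a< b< c< ha≢hb hb≢hc (inj₂ (p , q)) =
      inj₂ (lex-<-high c< b< (≢-sym hb≢hc) p , lex-<-high b< a< (≢-sym ha≢hb) q)

    between-low : ∀ {a b c} → high a ≡ high b → high b ≡ high c →
      Between (pos (lex F G)) a b c → Between (pos G) (low a) (low b) (low c)
    between-low ha≡hb hb≡hc (inj₁ (p , q)) = inj₁ (lex-<-low ha≡hb p , lex-<-low hb≡hc q)
    between-low ha≡hb hb≡hc (inj₂ (p , q)) = inj₂ (lex-<-low (sym hb≡hc) p , lex-<-low (sym ha≡hb) q)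

    not-between-block : ∀ {a b c} → a < m * m → b < m * m → c < m * m →
      high a ≢ high b → high b ≢ high c → high a ≡ high c → ¬ Between (pos (lex F G)) a b c
    not-between-block {b = b} a< b< c< ha≢hb hb≢hc ha≡hc between
      with between-high a< b< c< ha≢hb hb≢hc between
    ... | inj₁ (p , q) = <-asym p (subst (λ h → pos F (high b) < pos F h) (sym ha≡hc) q)
    ... | inj₂ (p , q) = <-asym q (subst (λ h → pos F h < pos F (high b)) (sym ha≡hc) p)

between? : {A : Set} (κ : A → ℕ) (a b c : A) → Dec (Between κ a b c)
between? κ a b c = ((κ a <? κ b) ×-dec (κ b <? κ c)) ⊎-dec ((κ c <? κ b) ×-dec (κ b <? κ a))

flip-breaks-between : {A : Set} {κ λ′ : A → ℕ} {a b c : A} →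
  (κ a < κ b → λ′ b < λ′ a) → (κ b < κ a → λ′ a < λ′ b) →
  (κ b < κ c → λ′ b < λ′ c) → (κ c < κ b → λ′ c < λ′ b) →
  Between κ a b c → ¬ Between λ′ a b c
flip-breaks-between ab ba bc cb (inj₁ (p , q)) (inj₁ (r , _)) = <-asym r (ab p)
flip-breaks-between ab ba bc cb (inj₁ (p , q)) (inj₂ (r , _)) = <-asym r (bc q)
flip-breaks-between ab ba bc cb (inj₂ (p , q)) (inj₁ (_ , r)) = <-asym r (cb p)
flip-breaks-between ab ba bc cb (inj₂ (p , q)) (inj₂ (_ , r)) = <-asym r (ba q)

-- The inductive step of the construction: from keys ψ₀ ∷ Ψ separating [0, m)
-- build keys Φ₀ ∷ Φ₁ ∷ Ψ′ separating [0, m * m), only one key more.  Here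
-- Φ₀ and Ψ′ are the lexicographic squares of ψ₀ and Ψ, and Φ₁ orders high
-- digits by ψ₀ but low digits by ψ₀ reversed.  A triple whose high digits are
-- all equal or all distinct is separated as its low resp. high digits are; if
-- exactly two high digits agree, Φ₀ or Φ₁ separates it.
module SquaredFamily (m : ℕ) {{_ : NonZero m}} (ψ₀ : Key m) (Ψ : List (Key m))
                     (separates : SeparatesBelow m (ψ₀ ∷ Ψ)) where
  open Lexicographic m

  diagonal : Key m → Key (m * m)
  diagonal ψ = lex ψ ψ

  Φ₀ Φ₁ : Key (m * m)
  Φ₀ = diagonal ψ₀
  Φ₁ = lex ψ₀ (reverse ψ₀)

  Φ₁-agrees : ∀ {x y} → x < m * m → y < m * m → high x ≢ high y →
    pos Φ₀ x < pos Φ₀ y → pos Φ₁ x < pos Φ₁ y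
  Φ₁-agrees x< y< hx≢hy lt = high-<-lex ψ₀ (reverse ψ₀) (lex-<-high ψ₀ ψ₀ x< y< hx≢hy lt)

  Φ₁-reverses : ∀ {x y} → high x ≡ high y → pos Φ₀ x < pos Φ₀ y → pos Φ₁ y < pos Φ₁ x
  Φ₁-reverses hx≡hy lt =
    low-<-lex ψ₀ (reverse ψ₀) (sym hx≡hy) (reverse-< ψ₀ low-< low-< (lex-<-low ψ₀ ψ₀ hx≡hy lt))

  insert-Φ₁ : ∀ {a b c} → KeySeparates (map diagonal (ψ₀ ∷ Ψ)) a b c → KeySeparates (Φ₀ ∷ Φ₁ ∷ map diagonal Ψ) a b c
  insert-Φ₁ (here p) = here p
  insert-Φ₁ (there p) = there (there p)

  lift-high : ∀ {a b c} → a < m * m → b < m * m → c < m * m → high a ≢ high b → high b ≢ high c →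
    (Ks : List (Key m)) → KeySeparates Ks (high a) (high b) (high c) → KeySeparates (map diagonal Ks) a b c
  lift-high a< b< c< ha≢hb hb≢hc Ks =
    map⁺ ∘ Any.map (λ {ψ} ¬between between → ¬between (between-high ψ ψ a< b< c< ha≢hb hb≢hc between))

  lift-low : ∀ {a b c} → high a ≡ high b → high b ≡ high c →
    (Ks : List (Key m)) → KeySeparates Ks (low a) (low b) (low c) → KeySeparates (map diagonal Ks) a b c
  lift-low ha≡hb hb≡hc Ks =
    map⁺ ∘ Any.map (λ {ψ} ¬between between → ¬between (between-low ψ ψ ha≡hb hb≡hc between))

  adjacent-pair : ∀ {a b c} → b < m * m → c < m * m → high a ≡ high b → high b ≢ high c →
    KeySeparates (Φ₀ ∷ Φ₁ ∷ map diagonal Ψ) a b c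
  adjacent-pair {a} {b} {c} b< c< ha≡hb hb≢hc with between? (pos Φ₀) a b c
  ... | no ¬between = here ¬between
  ... | yes between = there (here (flip-breaks-between {κ = pos Φ₀} {λ′ = pos Φ₁}
          (Φ₁-reverses ha≡hb) (Φ₁-reverses (sym ha≡hb))
          (Φ₁-agrees b< c< hb≢hc) (Φ₁-agrees c< b< (≢-sym hb≢hc)) between))

  squared-separates : SeparatesBelow (m * m) (Φ₀ ∷ Φ₁ ∷ map diagonal Ψ)
  squared-separates {a} {b} {c} a< b< c< a≢b a≢c b≢c
    with high a ≟ high b | high b ≟ high c | high a ≟ high c
  ... | yes ha≡hb | yes hb≡hc | _ =
    insert-Φ₁ (lift-low ha≡hb hb≡hc (ψ₀ ∷ Ψ) (separates low-< low-< low-<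
      (low-distinct ha≡hb a≢b) (low-distinct (trans ha≡hb hb≡hc) a≢c) (low-distinct hb≡hc b≢c)))
    where
    low-distinct : ∀ {x y} → high x ≡ high y → x ≢ y → low x ≢ low y
    low-distinct hx≡hy x≢y lx≡ly = x≢y (digits-injective hx≡hy lx≡ly)
  ... | yes ha≡hb | no hb≢hc | _ = adjacent-pair b< c< ha≡hb hb≢hc
  ... | no ha≢hb | yes hb≡hc | _ = key-separates-sym (adjacent-pair b< a< (sym hb≡hc) (≢-sym ha≢hb))
  ... | no ha≢hb | no hb≢hc | yes ha≡hc = here (not-between-block ψ₀ ψ₀ a< b< c< ha≢hb hb≢hc ha≡hc)
  ... | no ha≢hb | no hb≢hc | no ha≢hc =
    insert-Φ₁ (lift-high a< b< c< ha≢hb hb≢hc (ψ₀ ∷ Ψ)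
      (separates (high-< a<) (high-< b<) (high-< c<) ha≢hb ha≢hc hb≢hc))

record SeparatingFamily (M k : ℕ) : Set where
  field
    lead : Key M
    others : List (Key M)
    separates : SeparatesBelow M (lead ∷ others)
    others-length : length others ≡ k

tower-nonZero : ∀ k → NonZero (tower k)
tower-nonZero zero = _
tower-nonZero (suc k) = m*n≢0 (tower k) (tower k) {{tower-nonZero k}} {{tower-nonZero k}}

no-three-below-two : ∀ {a b c} → a < 2 → b < 2 → c < 2 → a ≢ b → a ≢ c → b ≢ c → ⊥
no-three-below-two {0} {0} _ _ _ a≢b _ _ = a≢b refl
no-three-below-two {1} {1} _ _ _ a≢b _ _ = a≢b refl
no-three-below-two {0} {1} {0} _ _ _ _ a≢c _ = a≢c refl
no-three-below-two {0} {1} {1} _ _ _ _ _ b≢c = b≢c refl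
no-three-below-two {1} {0} {0} _ _ _ _ _ b≢c = b≢c refl
no-three-below-two {1} {0} {1} _ _ _ _ a≢c _ = a≢c refl
no-three-below-two {suc (suc _)} (s≤s (s≤s ()))
no-three-below-two {_} {suc (suc _)} _ (s≤s (s≤s ()))
no-three-below-two {0} {1} {suc (suc _)} _ _ (s≤s (s≤s ()))
no-three-below-two {1} {0} {suc (suc _)} _ _ (s≤s (s≤s ()))

family : ∀ k → SeparatingFamily (tower k) k
family zero = record
  { lead = record { pos = λ x → x ; pos-< = λ x< → x< ; pos-injective = λ _ _ eq → eq }
  ; others = []
  ; separates = λ a< b< c< a≢b a≢c b≢c → ⊥-elim (no-three-below-two a< b< c< a≢b a≢c b≢c)
  ; others-length = refl
  }
family (suc k) = record
  { lead = Φ₀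
  ; others = Φ₁ ∷ map diagonal others
  ; separates = squared-separates
  ; others-length = cong suc (trans (length-map diagonal others) others-length)
  }
  where
  instance
    _ : NonZero (tower k)
    _ = tower-nonZero k
  open SeparatingFamily (family k)
  open SquaredFamily (tower k) lead others separates

position : {n : ℕ} → Ordering n → Fin n → ℕ
position φ x = toℕ (φ ⟨$⟩ʳ x)

position-injective : {n : ℕ} (φ : Ordering n) → Injective _≡_ _≡_ (position φ)
position-injective φ {x} {y} eq = begin
  x                       ≡⟨ inverseˡ φ ⟨
  φ ⟨$⟩ˡ (φ ⟨$⟩ʳ x)       ≡⟨ cong (φ ⟨$⟩ˡ_) (toℕ-injective eq) ⟩
  φ ⟨$⟩ˡ (φ ⟨$⟩ʳ y)       ≡⟨ inverseˡ φ ⟩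
  y                       ∎
  where open ≡-Reasoning

injective⇒surjective : ∀ {n} (f : Fin n → Fin n) → Injective _≡_ _≡_ f → ∀ y → ∃ λ x → f x ≡ y
injective⇒surjective {suc n} f f-inj y with Fin.any? (λ x → f x Fin.≟ y)
... | yes hit = hit
... | no miss with pigeonhole ≤-refl (λ x → punchOut {i = y} {j = f x} (λ y≡fx → miss (x , sym y≡fx)))
...   | i , j , i<j , same =
  ⊥-elim (<-irrefl (cong toℕ (f-inj (punchOut-injective (λ e → miss (i , sym e)) (λ e → miss (j , sym e)) same))) i<j)

-- An injective key on Fin n induces an ordering: place x at position equal to
-- the number of elements with smaller key.
module Ranking {n : ℕ} (κ : Fin n → ℕ) (κ-injective : Injective _≡_ _≡_ κ) where

  below : Fin n → Subset n
  below x = tabulate (λ y → κ y <ᵇ κ x)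

  below⁺ : ∀ {x y} → κ y < κ x → y ∈ₛ below x
  below⁺ {x} {y} lt = lookup⇒[]= y (below x) (trans (lookup∘tabulate _ y) (Equivalence.to T-≡ (<⇒<ᵇ lt)))

  below⁻ : ∀ {x y} → y ∈ₛ below x → κ y < κ x
  below⁻ {x} {y} y∈ =
    <ᵇ⇒< (κ y) (κ x) (Equivalence.from T-≡ (trans (sym (lookup∘tabulate _ y)) ([]=⇒lookup y∈)))

  ∉below : ∀ x → ¬ (x ∈ₛ below x)
  ∉below x x∈ = <-irrefl refl (below⁻ x∈)

  rank : Fin n → ℕ
  rank x = ∣ below x ∣

  rank-< : ∀ x → rank x < n
  rank-< x = subst (rank x <_) (∣⊤∣≡n n) (p⊂q⇒∣p∣<∣q∣ ((λ _ → ∈⊤) , x , ∈⊤ , ∉below x))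

  rank-mono : ∀ {x y} → κ x < κ y → rank x < rank y
  rank-mono {x} lt = p⊂q⇒∣p∣<∣q∣ ((λ z∈ → below⁺ (<-trans (below⁻ z∈) lt)) , x , below⁺ lt , ∉below x)

  rank-reflects : ∀ {x y} → rank x < rank y → κ x < κ y
  rank-reflects {x} {y} lt with <-cmp (κ x) (κ y)
  ... | tri< κx<κy _ _ = κx<κy
  ... | tri≈ _ κx≡κy _ = ⊥-elim (<-irrefl (cong rank (κ-injective κx≡κy)) lt)
  ... | tri> _ _ κy<κx = ⊥-elim (<-asym lt (rank-mono κy<κx))

  -- rank x < n, so ranking is an injective map Fin n → Fin n, hence a permutation
  ranking : Fin n → Fin n
  ranking x = fromℕ< (rank-< x)

  ranking≡⇒rank≡ : ∀ {x y} → ranking x ≡ ranking y → rank x ≡ rank y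
  ranking≡⇒rank≡ {x} {y} eq = trans (sym (toℕ-fromℕ< (rank-< x))) (trans (cong toℕ eq) (toℕ-fromℕ< (rank-< y)))

  ranking-injective : Injective _≡_ _≡_ ranking
  ranking-injective {x} {y} eq with <-cmp (κ x) (κ y)
  ... | tri< κx<κy _ _ = ⊥-elim (<-irrefl (ranking≡⇒rank≡ eq) (rank-mono κx<κy))
  ... | tri≈ _ κx≡κy _ = κ-injective κx≡κy
  ... | tri> _ _ κy<κx = ⊥-elim (<-irrefl (sym (ranking≡⇒rank≡ eq)) (rank-mono κy<κx))

  ordering : Ordering n
  ordering = permutation ranking (λ y → proj₁ (onto y)) (λ y → proj₂ (onto y))
                                 (λ x → ranking-injective (proj₂ (onto (ranking x))))
    where
    onto : ∀ y → ∃ λ x → ranking x ≡ y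
    onto = injective⇒surjective ranking ranking-injective

  ordering-reflects : ∀ {x y} → position ordering x < position ordering y → κ x < κ y
  ordering-reflects {x} {y} lt =
    rank-reflects (subst₂ _<_ (toℕ-fromℕ< (rank-< x)) (toℕ-fromℕ< (rank-< y)) lt)

  ordering-between : ∀ {a b c} → Between (position ordering) a b c → Between κ a b c
  ordering-between (inj₁ (p , q)) = inj₁ (ordering-reflects p , ordering-reflects q)
  ordering-between (inj₂ (p , q)) = inj₂ (ordering-reflects p , ordering-reflects q)

tower≡2^2^ : ∀ k → tower k ≡ 2 ^ 2 ^ k
tower≡2^2^ zero = refl
tower≡2^2^ (suc k) = begin
  tower k * tower k          ≡⟨ cong₂ _*_ (tower≡2^2^ k) (tower≡2^2^ k) ⟩
  2 ^ 2 ^ k * 2 ^ 2 ^ k      ≡⟨ ^-distribˡ-+-* 2 (2 ^ k) (2 ^ k) ⟨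
  2 ^ (2 ^ k + 2 ^ k)        ≡⟨ cong (λ e → 2 ^ (2 ^ k + e)) (+-identityʳ (2 ^ k)) ⟨
  2 ^ 2 ^ suc k              ∎
  where open ≡-Reasoning

-- The ceiling logarithm is large enough: n ≤ 2 ^ ⌈log₂ n ⌉.  The proof follows
-- the recursion ⌈log₂ (2 + n) ⌉ = 1 + ⌈log₂ (1 + ⌈ n /2⌉) ⌉ defining ⌈log₂_⌉.
≤2^⌈log2⌉ : ∀ n (rec : Acc _<_ n) → n ≤ 2 ^ ⌈log2⌉ n rec
≤2^⌈log2⌉ zero _ = z≤n
≤2^⌈log2⌉ (suc zero) _ = ≤-refl
≤2^⌈log2⌉ (suc (suc n)) (acc _) = begin
    2 + n                      ≤⟨ +-monoʳ-≤ 2 n≤2h ⟩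
    2 + (h + h)                ≡⟨ cong suc (+-suc h h) ⟨
    suc h + suc h              ≤⟨ +-mono-≤ ih ih ⟩
    t + t                      ≡⟨ cong (t +_) (+-identityʳ t) ⟨
    2 * t                      ∎
  where
  open ≤-Reasoning
  h t : ℕ
  h = ⌈ n /2⌉
  t = 2 ^ ⌈log2⌉ (suc h) _
  ih : suc h ≤ t
  ih = ≤2^⌈log2⌉ (suc h) _
  n≤2h : n ≤ h + h
  n≤2h = subst (_≤ h + h) (⌊n/2⌋+⌈n/2⌉≡n n) (+-monoˡ-≤ h (⌊n/2⌋≤⌈n/2⌉ n))

≤2^⌈log₂⌉ : ∀ n → n ≤ 2 ^ ⌈log₂ n ⌉
≤2^⌈log₂⌉ n = ≤2^⌈log2⌉ n _

≤tower-loglog : ∀ n → n ≤ tower ⌈log₂ ⌈log₂ n ⌉ ⌉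
≤tower-loglog n = begin
  n                                ≤⟨ ≤2^⌈log₂⌉ n ⟩
  2 ^ ⌈log₂ n ⌉                    ≤⟨ ^-monoʳ-≤ 2 (≤2^⌈log₂⌉ ⌈log₂ n ⌉) ⟩
  2 ^ 2 ^ ⌈log₂ ⌈log₂ n ⌉ ⌉        ≡⟨ tower≡2^2^ ⌈log₂ ⌈log₂ n ⌉ ⌉ ⟨
  tower ⌈log₂ ⌈log₂ n ⌉ ⌉          ∎
  where open ≤-Reasoning

loglog-minimal : ∀ n k → n ≤ tower k → ⌈log₂ ⌈log₂ n ⌉ ⌉ ≤ k
loglog-minimal n k n≤tower = begin
  ⌈log₂ ⌈log₂ n ⌉ ⌉                ≤⟨ ⌈log₂⌉-mono-≤ (⌈log₂⌉-mono-≤ (subst (n ≤_) (tower≡2^2^ k) n≤tower)) ⟩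
  ⌈log₂ ⌈log₂ 2 ^ 2 ^ k ⌉ ⌉        ≡⟨ cong ⌈log₂_⌉ (⌈log₂2^n⌉≡n (2 ^ k)) ⟩
  ⌈log₂ 2 ^ k ⌉                    ≡⟨ ⌈log₂2^n⌉≡n k ⟩
  k                                ∎
  where open ≤-Reasoning

-- Upper bound: n ≤ tower k elements admit k + 1 orderings nonbetween-satisfying
-- every constraint, namely the restrictions to [0, n) of the family of level k.
upper-bound : ∀ n k → n ≤ tower k → ∃ λ (S : OrderSystem n) → length S ≡ k + 1 × NonBetweenAll S
upper-bound n k n≤tower = map restrict (lead ∷ others) , size , nonbetween
  where
  open SeparatingFamily (family k)
  below-M : ∀ (x : Fin n) → toℕ x < tower k
  below-M x = ≤-trans (Fin.toℕ<n x) n≤tower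
  restricted-injective : ∀ K → Injective _≡_ _≡_ (λ (x : Fin n) → pos K (toℕ x))
  restricted-injective K {x} {y} eq = toℕ-injective (pos-injective K (below-M x) (below-M y) eq)
  restrict : Key (tower k) → Ordering n
  restrict K = Ranking.ordering (λ x → pos K (toℕ x)) (restricted-injective K)
  size : length (map restrict (lead ∷ others)) ≡ k + 1
  size = trans (length-map restrict (lead ∷ others)) (trans (cong suc others-length) (+-comm 1 k))
  nonbetween : NonBetweenAll (map restrict (lead ∷ others))
  nonbetween (constraint a b c a≢b a≢c b≢c) = map⁺ (Any.map
    (λ {K} ¬between between →
       ¬between (Ranking.ordering-between (λ x → pos K (toℕ x)) (restricted-injective K) between))
    (separates (below-M a) (below-M b) (below-M c)
               (a≢b ∘ toℕ-injective) (a≢c ∘ toℕ-injective) (b≢c ∘ toℕ-injective)))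

empty-system-fails : ∀ {n} → 3 ≤ n → ¬ NonBetweenAll {n} []
empty-system-fails {suc (suc (suc _))} (s≤s (s≤s (s≤s z≤n))) all =
  ¬Any[] (all (constraint zero (suc zero) (suc (suc zero)) (λ ()) (λ ()) (λ ())))

-- Lower bound: if φ ∷ S nonbetween-satisfies every constraint on [n], the
-- positions in these orderings are length S + 1 injective keys separating all
-- of Fin n, so n ≤ tower (length S).
system-lower-bound : ∀ {n} (φ : Ordering n) (S : OrderSystem n) → NonBetweenAll (φ ∷ S) → n ≤ tower (length S)
system-lower-bound {n} φ S all = begin
  n                                ≡⟨ length-tabulate (λ x → x) ⟨
  length (allFin n)                ≤⟨ LowerBound.lower-bound (position φ) (map position S) (position-injective φ)
                                        (AllP.map⁺ (All.universal position-injective S)) (allFin n) (allFin⁺ n) separated ⟩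
  tower (length (map position S))  ≡⟨ cong tower (length-map position S) ⟩
  tower (length S)                 ∎
  where
  open ≤-Reasoning
  separated : LowerBound.SeparatedOn (map position (φ ∷ S)) (allFin n)
  separated {a} {b} {c} _ _ _ a≢b a≢c b≢c = map⁺ (all (constraint a b c a≢b a≢c b≢c))

theorem1p5 : (n : ℕ) → 3 ≤ n → IsNbet n (⌈log₂ ⌈log₂ n ⌉ ⌉ + 1)
theorem1p5 n 3≤n = upper-bound n k (≤tower-loglog n) , minimal
  where
  k : ℕ
  k = ⌈log₂ ⌈log₂ n ⌉ ⌉
  minimal : (S : OrderSystem n) → NonBetweenAll S → k + 1 ≤ length S
  minimal [] all = ⊥-elim (empty-system-fails 3≤n all)
  minimal (φ ∷ S) all =
    subst (_≤ suc (length S)) (+-comm 1 k) (s≤s (loglog-minimal n (length S) (system-lower-bound φ S all)))
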